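{- Let $m=3b+g$ and $n=3c+h$ be positive integers, where $b,c$ are nonnegative integers and $0\le g,h\le 2$. Then $va^\equiv_1(K_{m,n})\le b+c+2$.
   Context: All graphs are finite and simple. For a graph $G$ with $N=|V(G)|$ vertices, an equitable $(q,r)$-tree-coloring of $G$ is a partition of $V(G)$ into $q$ sets, each of size $\lfloor N/q\rfloor$ or $\lceil N/q\rceil$, such that each set induces a forest of maximum degree at most $r$. The strong equitable vertex $r$-arboricity $va^\equiv_r(G)$ is the minimum $p$ such that $G$ has an equitable $(q,r)$-tree-coloring for every integer $q\ge p$. $K_{m,n}$ is the complete bipartite graph with parts of sizes $m$ and $n$. -}

module Defs where

open import Data.Nat using (ℕ; zero; suc; _+_; _∸_; _≤_; _<_)
open import Data.Nat.DivMod using (_/_)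
open import Data.Nat.Properties using (_<?_; _≤?_)
open import Data.Bool using (Bool; true; false; _∧_; _∨_; T)
open import Data.Fin using (Fin; toℕ; _≟_)
open import Data.List using (List; []; _∷_; length; filterᵇ; allFin; _∷ʳ_)
open import Data.List.Relation.Unary.All using (All)
open import Data.List.Relation.Unary.Linked using (Linked)
open import Data.List.Relation.Unary.Unique.Propositional using (Unique)
open import Data.Product using (Σ; _×_)
open import Data.Sum using (_⊎_)
open import Relation.Binary.PropositionalEquality using (_≡_; refl; subst; sym)
open import Relation.Nullary using (¬_; does; yes; no)
open import Data.Bool.Properties using (∨-comm)
open import Data.Nat.Properties using (<⇒≱; <ᵇ⇒<; ≤ᵇ⇒≤)
open import Data.Nat using (_<ᵇ_; _≤ᵇ_)
open import Data.Unit using (tt)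
open import Data.Empty using (⊥-elim)

record Graph : Set where
  field
    N      : ℕ
    adj    : Fin N → Fin N → Bool
    symm   : ∀ u v → adj u v ≡ adj v u
    irrefl : ∀ v → adj v v ≡ false
open Graph public

-- Complete bipartite graph K_{m,n}: vertices 0..m-1 form one part,
-- vertices m..m+n-1 the other part.
bip : (m n : ℕ) → Fin (m + n) → Fin (m + n) → Bool
bip m n u v =
  ((toℕ u <ᵇ m) ∧ (m ≤ᵇ toℕ v)) ∨ ((toℕ v <ᵇ m) ∧ (m ≤ᵇ toℕ u))

bip-sym : ∀ m n u v → bip m n u v ≡ bip m n v u
bip-sym m n u v = ∨-comm ((toℕ u <ᵇ m) ∧ (m ≤ᵇ toℕ v)) ((toℕ v <ᵇ m) ∧ (m ≤ᵇ toℕ u))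

bip-irrefl : ∀ m n v → bip m n v v ≡ false
bip-irrefl m n v with toℕ v <ᵇ m in e1 | m ≤ᵇ toℕ v in e2
... | true | true = ⊥-elim (<⇒≱ (<ᵇ⇒< (toℕ v) m (subst T (sym e1) tt)) (≤ᵇ⇒≤ m (toℕ v) (subst T (sym e2) tt)))
... | true | false = refl
... | false | true = refl
... | false | false = refl

K : ℕ → ℕ → Graph
K m n = record { N = m + n ; adj = bip m n ; symm = bip-sym m n ; irrefl = bip-irrefl m n }

-- ⌊ a / q ⌋ and ⌈ a / q ⌉ (with the harmless convention value 0 for q = 0).
floorDiv : ℕ → ℕ → ℕ
floorDiv a zero = 0
floorDiv a (suc k) = a / suc k

ceilDiv : ℕ → ℕ → ℕ
ceilDiv a zero = 0
ceilDiv a (suc k) = (a + k) / suc k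

module _ (G : Graph) {q : ℕ} (col : Fin (N G) → Fin q) where
  classSize : Fin q → ℕ
  classSize i = length (filterᵇ (λ v → does (col v ≟ i)) (allFin (N G)))

  classDeg : Fin (N G) → ℕ
  classDeg v = length (filterᵇ (λ w → adj G v w ∧ does (col w ≟ col v)) (allFin (N G)))

  -- a cycle (length ≥ 3, distinct vertices) inside colour class i
  CycleIn : Fin q → Set
  CycleIn i = Σ (Fin (N G)) λ v → Σ (List (Fin (N G))) λ ws →
    (2 ≤ length ws) × Unique (v ∷ ws) × All (λ w → col w ≡ i) (v ∷ ws) ×
    Linked (λ a b → T (adj G a b)) ((v ∷ ws) ∷ʳ v)

  IsTreeColoring : ℕ → Set
  IsTreeColoring r = (∀ i → ¬ CycleIn i) × (∀ v → classDeg v ≤ r)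

  IsEquitable : Set
  IsEquitable = ∀ i → (classSize i ≡ floorDiv (N G) q) ⊎ (classSize i ≡ ceilDiv (N G) q)

EquitableTreeColorable : Graph → ℕ → ℕ → Set
EquitableTreeColorable G q r =
  Σ (Fin (N G) → Fin q) λ col → IsEquitable G col × IsTreeColoring G col r

-- va^≡_r(G) ≤ p  ⟺  G has an equitable (q,r)-tree-coloring for every q ≥ p
-- (va^≡_r(G) is the least p with this upward-closed property; it exists
-- since q ≥ N always works.)
StrongVaAtMost : Graph → ℕ → ℕ → Set
StrongVaAtMost G r p = ∀ q → p ≤ q → EquitableTreeColorable G q r

-- Color the vertices 0 … N-1 of K_{m,n} (N = m + n; one part is [0, m), the other [m, N)) by
-- consecutive blocks whose sizes are ⌊N/q⌋ or ⌈N/q⌉.  A block induces a forest of maximum degree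
-- at most 1 as soon as it has at most two vertices or lies inside one part.  Since
-- N ≤ 3b + 3c + 4 < 3q, blocks have at most three vertices, and if ⌊N/q⌋ ≤ 1 at most two.
-- Otherwise there are t = N mod q triples and q - t pairs.  If t ≤ b all triples go first,
-- inside the part of size m ≥ 3b; if t > b, b triples go first, then one pair covering the at
-- most two remaining vertices of that part, and the other triples after it, in the other part.
module Submission where

open import Defs
open import Data.Bool using (Bool; true; false; T; not; _∧_; _xor_; if_then_else_)
open import Data.Bool.Properties using (∧-comm; xor-same; T-∧)
open import Data.Fin using (Fin; zero; suc; toℕ; fromℕ<; _≟_)
open import Data.Fin.Properties using (toℕ<n; toℕ-fromℕ<)
open import Data.List using (List; []; _∷_; _++_; length; lookup; replicate; filterᵇ; tabulate)
open import Data.List.Membership.Propositional using (_∈_)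
open import Data.List.Membership.Propositional.Properties using (∈-allFin; ∈-lookup)
open import Data.List.Properties using (length-++; length-replicate)
open import Data.List.Relation.Unary.All as All using (All; []; _∷_)
open import Data.List.Relation.Unary.All.Properties using (++⁺; replicate⁺)
open import Data.List.Relation.Unary.AllPairs using (_∷_)
open import Data.List.Relation.Unary.Any using (here; there)
open import Data.List.Relation.Unary.Linked using (_∷_)
open import Data.Nat
  using (ℕ; zero; suc; _+_; _*_; _∸_; _≤_; _<_; _≡ᵇ_; _<ᵇ_; _≤ᵇ_; z≤n; s≤s; z<s; s<s; NonZero; >-nonZero)
open import Data.Nat.DivMod
  using (_/_; _%_; m≡m%n+[m/n]*n; m%n<n; +-distrib-/-∣ʳ; m<n⇒m/n≡0; m*n/n≡m; m<n*o⇒m/o<n)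
open import Data.Nat.Divisibility using (n∣m*n)
open import Data.Nat.ListAction using (sum)
open import Data.Nat.ListAction.Properties using (sum-++)
open import Data.Nat.Properties hiding (_≟_)
open import Data.Nat.Tactic.RingSolver using (solve-∀)
open import Data.Product using (_×_; _,_)
open import Data.Sum using (_⊎_; inj₁; inj₂)
open import Data.Unit using (⊤; tt)
open import Function using (_∘_; id)
open import Function.Bundles using (Equivalence)
open import Relation.Binary.PropositionalEquality
open import Relation.Nullary using (¬_; Dec; does; yes; no; contradiction)
open import Relation.Nullary.Decidable using (dec-true)

-- Counting

count : (ℕ → Bool) → ℕ → ℕ
count P zero    = 0
count P (suc n) = if P 0 then suc (count (P ∘ suc) n) else count (P ∘ suc) n

count-cong : ∀ {P Q} n → (∀ k → k < n → P k ≡ Q k) → count P n ≡ count Q n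
count-cong zero    eq = refl
count-cong (suc n) eq
  rewrite eq 0 z<s | count-cong n (λ k k<n → eq (suc k) (s<s k<n)) = refl

count-+ : ∀ P m n → count P (m + n) ≡ count P m + count (λ k → P (m + k)) n
count-+ P zero    n = refl
count-+ P (suc m) n with P 0
... | true  = cong suc (count-+ (P ∘ suc) m n)
... | false = count-+ (P ∘ suc) m n

count-true : ∀ n → count (λ _ → true) n ≡ n
count-true zero    = refl
count-true (suc n) = cong suc (count-true n)

count-false : ∀ {P} n → (∀ k → k < n → P k ≡ false) → count P n ≡ 0
count-false zero    eq = refl
count-false (suc n) eq rewrite eq 0 z<s = count-false n (λ k k<n → eq (suc k) (s<s k<n))

count-≤ : ∀ P n → count P n ≤ n
count-≤ P zero    = z≤n
count-≤ P (suc n) with P 0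
... | true  = s≤s (count-≤ (P ∘ suc) n)
... | false = m≤n⇒m≤1+n (count-≤ (P ∘ suc) n)

count-< : ∀ {P k n} → k < n → P k ≡ false → count P n < n
count-< {P} {zero}  {suc n} _ P0 rewrite P0 = s≤s (count-≤ (P ∘ suc) n)
count-< {P} {suc k} {suc n} (s≤s k<n) Pk with P 0
... | true  = s<s (count-< k<n Pk)
... | false = m<n⇒m<1+n (count-< k<n Pk)

length-filterᵇ-tabulate : ∀ {A : Set} {n} (f : Fin n → A) (p : A → Bool) (P : ℕ → Bool) →
  (∀ i → p (f i) ≡ P (toℕ i)) → length (filterᵇ p (tabulate f)) ≡ count P n
length-filterᵇ-tabulate {n = zero}  f p P eq = refl
length-filterᵇ-tabulate {n = suc n} f p P eq with p (f zero) | P 0 | eq zero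
... | true  | .true  | refl = cong suc (length-filterᵇ-tabulate (f ∘ suc) p (P ∘ suc) (eq ∘ suc))
... | false | .false | refl = length-filterᵇ-tabulate (f ∘ suc) p (P ∘ suc) (eq ∘ suc)

n≤m⇒m<n+o⇒m∸n<o : ∀ {m n o} → n ≤ m → m < n + o → m ∸ n < o
n≤m⇒m<n+o⇒m∸n<o {n = n} {o} n≤m m<n+o = subst (_ <_) (m+n∸m≡n n o) (∸-monoˡ-< m<n+o n≤m)

-- Consecutive blocks

block : List ℕ → ℕ → ℕ
block []      k = 0
block (s ∷ L) k with k <? s
... | yes _ = 0
... | no  _ = suc (block L (k ∸ s))

block-< : ∀ {s L k} → k < s → block (s ∷ L) k ≡ 0
block-< {s} {L} {k} k<s with k <? s
... | yes _   = refl
... | no  k≮s = contradiction k<s k≮s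

block-+ : ∀ s L k → block (s ∷ L) (s + k) ≡ suc (block L k)
block-+ s L k with s + k <? s
... | yes s+k<s = contradiction s+k<s (m+n≮m s k)
... | no  _     = cong (suc ∘ block L) (m+n∸m≡n s k)

block<length : ∀ L k → k < sum L → block L k < length L
block<length (s ∷ L) k k< with k <? s
... | yes _   = z<s
... | no  k≮s = s<s (block<length L (k ∸ s) (n≤m⇒m<n+o⇒m∸n<o (≮⇒≥ k≮s) k<))

count-block-∷ : ∀ s L (Q : ℕ → ℕ → Bool) →
  count (λ l → Q l (block (s ∷ L) l)) (s + sum L) ≡
  count (λ l → Q l 0) s + count (λ l → Q (s + l) (suc (block L l))) (sum L)
count-block-∷ s L Q =
  trans (count-+ _ s (sum L))
        (cong₂ _+_ (count-cong s (λ l l<s → cong (Q l) (block-< l<s)))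
                   (count-cong (sum L) (λ l _ → cong (Q (s + l)) (block-+ s L l))))

count-block : ∀ L (i : Fin (length L)) → count (λ k → block L k ≡ᵇ toℕ i) (sum L) ≡ lookup L i
count-block (s ∷ L) zero = begin
  count (λ k → block (s ∷ L) k ≡ᵇ 0) (s + sum L)
    ≡⟨ count-block-∷ s L (λ _ j → j ≡ᵇ 0) ⟩
  count (λ _ → true) s + count (λ _ → false) (sum L)
    ≡⟨ cong₂ _+_ (count-true s) (count-false (sum L) (λ _ _ → refl)) ⟩
  s + 0
    ≡⟨ +-identityʳ s ⟩
  s ∎
  where open ≡-Reasoning
count-block (s ∷ L) (suc i) = begin
  count (λ k → block (s ∷ L) k ≡ᵇ suc (toℕ i)) (s + sum L)
    ≡⟨ count-block-∷ s L (λ _ j → j ≡ᵇ suc (toℕ i)) ⟩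
  count (λ _ → false) s + count (λ k → block L k ≡ᵇ toℕ i) (sum L)
    ≡⟨ cong₂ _+_ (count-false s (λ _ _ → refl)) (count-block L i) ⟩
  lookup L i ∎
  where open ≡-Reasoning

crossing : ℕ → ℕ → ℕ → Bool
crossing m k l = does (k <? m) xor does (l <? m)

crossing-refl : ∀ m k → crossing m k k ≡ false
crossing-refl m k = xor-same (does (k <? m))

crossing-below : ∀ {m k l} → k < m → l < m → crossing m k l ≡ false
crossing-below {m} {k} {l} k<m l<m = cong₂ _xor_ (dec-true (k <? m) k<m) (dec-true (l <? m) l<m)

<ᵇ-shift : ∀ s k m → (s + k <ᵇ m) ≡ (k <ᵇ m ∸ s)
<ᵇ-shift zero    k m       = refl
<ᵇ-shift (suc s) k zero    = refl
<ᵇ-shift (suc s) k (suc m) = <ᵇ-shift s k m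

crossing-shift : ∀ m s k l → crossing m (s + k) (s + l) ≡ crossing (m ∸ s) k l
crossing-shift m s k l = cong₂ _xor_ (<ᵇ-shift s k m) (<ᵇ-shift s l m)

≤ᵇ≡not<ᵇ : ∀ m n → (m ≤ᵇ n) ≡ not (n <ᵇ m)
≤ᵇ≡not<ᵇ zero          n       = refl
≤ᵇ≡not<ᵇ (suc m)       zero    = refl
≤ᵇ≡not<ᵇ (suc zero)    (suc n) = refl
≤ᵇ≡not<ᵇ (suc (suc m)) (suc n) = ≤ᵇ≡not<ᵇ (suc m) n

bip≡crossing : ∀ m n u v → bip m n u v ≡ crossing m (toℕ u) (toℕ v)
bip≡crossing m n u v rewrite ≤ᵇ≡not<ᵇ m (toℕ u) | ≤ᵇ≡not<ᵇ m (toℕ v)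
  with toℕ u <ᵇ m | toℕ v <ᵇ m
... | true  | true  = refl
... | true  | false = refl
... | false | true  = refl
... | false | false = refl

-- The threshold m is measured from the start of the remaining blocks: each block has at most two
-- elements, lies below the threshold (s ≤ m), or lies above it (m ≡ 0).
Admissible : ℕ → List ℕ → Set
Admissible m []      = ⊤
Admissible m (s ∷ L) = (s ≤ 2 ⊎ s ≤ m ⊎ m ≡ 0) × Admissible (m ∸ s) L

admissible-small : ∀ {m L} → All (_≤ 2) L → Admissible m L
admissible-small []           = tt
admissible-small (s≤2 ∷ s≤2s) = inj₁ s≤2 , admissible-small s≤2s

admissible-below : ∀ {m} L → sum L ≤ m → Admissible m L
admissible-below     []      _  = tt
admissible-below {m} (s ∷ L) le =
  inj₂ (inj₁ (m+n≤o⇒m≤o s le)) ,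
  admissible-below L (m+n≤o⇒m≤o∸n (sum L) (subst (_≤ m) (+-comm s (sum L)) le))

admissible-above : ∀ L → Admissible 0 L
admissible-above []      = tt
admissible-above (s ∷ L) =
  inj₂ (inj₂ refl) , subst (λ m → Admissible m L) (sym (0∸n≡0 s)) (admissible-above L)

admissible-++ : ∀ {m} P {Q} → Admissible m P → Admissible (m ∸ sum P) Q → Admissible m (P ++ Q)
admissible-++     []      _            adm-Q = adm-Q
admissible-++ {m} (s ∷ P) {Q} (adm-s , adm-P) adm-Q =
  adm-s , admissible-++ P adm-P (subst (λ m → Admissible m Q) (sym (∸-+-assoc m s (sum P))) adm-Q)

blockDegree : ℕ → List ℕ → ℕ → ℕ
blockDegree m L k = count (λ l → (block L l ≡ᵇ block L k) ∧ crossing m k l) (sum L)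

blockDegree-head : ∀ m s L {k} → k < s → blockDegree m (s ∷ L) k ≡ count (crossing m k) s
blockDegree-head m s L {k} k<s = begin
  blockDegree m (s ∷ L) k
    ≡⟨ count-block-∷ s L (λ l j → (j ≡ᵇ block (s ∷ L) k) ∧ crossing m k l) ⟩
  count (λ l → (0 ≡ᵇ block (s ∷ L) k) ∧ crossing m k l) s +
  count (λ l → (suc (block L l) ≡ᵇ block (s ∷ L) k) ∧ crossing m k (s + l)) (sum L)
    ≡⟨ cong (λ j → count (λ l → (0 ≡ᵇ j) ∧ crossing m k l) s +
                   count (λ l → (suc (block L l) ≡ᵇ j) ∧ crossing m k (s + l)) (sum L)) (block-< k<s) ⟩
  count (crossing m k) s + count (λ _ → false) (sum L)
    ≡⟨ cong (count (crossing m k) s +_) (count-false (sum L) (λ _ _ → refl)) ⟩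
  count (crossing m k) s + 0
    ≡⟨ +-identityʳ _ ⟩
  count (crossing m k) s ∎
  where open ≡-Reasoning

blockDegree-tail : ∀ m s L k → blockDegree m (s ∷ L) (s + k) ≡ blockDegree (m ∸ s) L k
blockDegree-tail m s L k = begin
  blockDegree m (s ∷ L) (s + k)
    ≡⟨ count-block-∷ s L (λ l j → (j ≡ᵇ block (s ∷ L) (s + k)) ∧ crossing m (s + k) l) ⟩
  count (λ l → (0 ≡ᵇ block (s ∷ L) (s + k)) ∧ crossing m (s + k) l) s +
  count (λ l → (suc (block L l) ≡ᵇ block (s ∷ L) (s + k)) ∧ crossing m (s + k) (s + l)) (sum L)
    ≡⟨ cong (λ j → count (λ l → (0 ≡ᵇ j) ∧ crossing m (s + k) l) s +
                   count (λ l → (suc (block L l) ≡ᵇ j) ∧ crossing m (s + k) (s + l)) (sum L)) (block-+ s L k) ⟩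
  count (λ _ → false) s + count (λ l → (block L l ≡ᵇ block L k) ∧ crossing m (s + k) (s + l)) (sum L)
    ≡⟨ cong₂ _+_ (count-false s (λ _ _ → refl))
         (count-cong (sum L) (λ l _ → cong ((block L l ≡ᵇ block L k) ∧_) (crossing-shift m s k l))) ⟩
  blockDegree (m ∸ s) L k ∎
  where open ≡-Reasoning

count-crossing≤1 : ∀ {m s k} → (s ≤ 2 ⊎ s ≤ m ⊎ m ≡ 0) → k < s → count (crossing m k) s ≤ 1
count-crossing≤1 {m} {k = k} (inj₁ s≤2) k<s = ≤-pred (≤-trans (count-< k<s (crossing-refl m k)) s≤2)
count-crossing≤1 {s = s} (inj₂ (inj₁ s≤m)) k<s = ≤-trans (≤-reflexive (count-false s below)) z≤n
  where below = λ l l<s → crossing-below (<-≤-trans k<s s≤m) (<-≤-trans l<s s≤m)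
count-crossing≤1 {s = s} (inj₂ (inj₂ refl)) k<s = ≤-trans (≤-reflexive (count-false s (λ _ _ → refl))) z≤n

blockDegree≤1 : ∀ m L k → Admissible m L → k < sum L → blockDegree m L k ≤ 1
blockDegree≤1 m (s ∷ L) k (adm-s , adm-L) k< = byPosition (k <? s)
  where
    byPosition : Dec (k < s) → blockDegree m (s ∷ L) k ≤ 1
    byPosition (yes k<s) = subst (_≤ 1) (sym (blockDegree-head m s L k<s)) (count-crossing≤1 adm-s k<s)
    byPosition (no  k≮s) = subst (λ k → blockDegree m (s ∷ L) k ≤ 1) (m+[n∸m]≡n s≤k)
      (subst (_≤ 1) (sym (blockDegree-tail m s L (k ∸ s)))
         (blockDegree≤1 (m ∸ s) L (k ∸ s) adm-L (n≤m⇒m<n+o⇒m∸n<o s≤k k<)))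
      where s≤k = ≮⇒≥ k≮s

-- Block colorings of complete bipartite graphs

does-≟ : ∀ {n} (i j : Fin n) → does (i ≟ j) ≡ (toℕ i ≡ᵇ toℕ j)
does-≟ zero    zero    = refl
does-≟ zero    (suc j) = refl
does-≟ (suc i) zero    = refl
does-≟ (suc i) (suc j) = does-≟ i j

1≤length-filterᵇ : ∀ {A : Set} (p : A → Bool) {x xs} → x ∈ xs → T (p x) → 1 ≤ length (filterᵇ p xs)
1≤length-filterᵇ p {xs = y ∷ ys} (here refl) px with p y
... | true = s≤s z≤n
1≤length-filterᵇ p {xs = y ∷ ys} (there x∈) px with p y
... | true  = m≤n⇒m≤1+n (1≤length-filterᵇ p x∈ px)
... | false = 1≤length-filterᵇ p x∈ px

2≤length-filterᵇ : ∀ {A : Set} (p : A → Bool) {x y xs} → x ∈ xs → y ∈ xs → x ≢ y →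
  T (p x) → T (p y) → 2 ≤ length (filterᵇ p xs)
2≤length-filterᵇ p (here refl) (here refl) x≢y _ _ = contradiction refl x≢y
2≤length-filterᵇ p {xs = z ∷ zs} (here refl) (there y∈) _ px py with p z
... | true = s≤s (1≤length-filterᵇ p y∈ py)
2≤length-filterᵇ p {xs = z ∷ zs} (there x∈) (here refl) _ px py with p z
... | true = s≤s (1≤length-filterᵇ p x∈ px)
2≤length-filterᵇ p {xs = z ∷ zs} (there x∈) (there y∈) x≢y px py with p z
... | true  = m≤n⇒m≤1+n (2≤length-filterᵇ p x∈ y∈ x≢y px py)
... | false = 2≤length-filterᵇ p x∈ y∈ x≢y px py

classDeg≤1⇒¬CycleIn : ∀ G {q} (col : Fin (N G) → Fin q) →
  (∀ v → classDeg G col v ≤ 1) → ∀ i → ¬ CycleIn G col i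
classDeg≤1⇒¬CycleIn G col deg≤1 i
  (v , w₁ ∷ w₂ ∷ _ , _ , ((_ ∷ v≢w₂ ∷ _) ∷ _) , (cv ∷ cw₁ ∷ cw₂ ∷ _) , (v~w₁ ∷ w₁~w₂ ∷ _)) =
  <⇒≱ (2≤length-filterᵇ p (∈-allFin v) (∈-allFin w₂) v≢w₂ (neighbour (subst T (symm G v w₁) v~w₁) cv)
                                                           (neighbour w₁~w₂ cw₂))
      (deg≤1 w₁)
  where
    p : Fin (N G) → Bool
    p w = adj G w₁ w ∧ does (col w ≟ col w₁)
    neighbour : ∀ {w} → T (adj G w₁ w) → col w ≡ i → T (p w)
    neighbour {w} w₁~w cw =
      Equivalence.from T-∧ (w₁~w , subst T (sym (dec-true (col w ≟ col w₁) (trans cw (sym cw₁)))) tt)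
classDeg≤1⇒¬CycleIn G col deg≤1 i (v , []     , () , _)
classDeg≤1⇒¬CycleIn G col deg≤1 i (v , _ ∷ [] , s≤s () , _)

EquitableSize : ℕ → ℕ → ℕ → Set
EquitableSize N q c = c ≡ floorDiv N q ⊎ c ≡ ceilDiv N q

module BlockColoring (m n : ℕ) (L : List ℕ) (sum≡ : sum L ≡ m + n) where

  color : Fin (m + n) → Fin (length L)
  color v = fromℕ< (block<length L (toℕ v) (subst (toℕ v <_) (sym sum≡) (toℕ<n v)))

  toℕ-color : ∀ v → toℕ (color v) ≡ block L (toℕ v)
  toℕ-color v = toℕ-fromℕ< _

  classSize-color : ∀ i → classSize (K m n) color i ≡ lookup L i
  classSize-color i = begin
    classSize (K m n) color i
      ≡⟨ length-filterᵇ-tabulate id _ _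
           (λ v → trans (does-≟ (color v) i) (cong (_≡ᵇ toℕ i) (toℕ-color v))) ⟩
    count (λ k → block L k ≡ᵇ toℕ i) (m + n)
      ≡⟨ cong (count _) (sym sum≡) ⟩
    count (λ k → block L k ≡ᵇ toℕ i) (sum L)
      ≡⟨ count-block L i ⟩
    lookup L i ∎
    where open ≡-Reasoning

  classDeg-color : ∀ v → classDeg (K m n) color v ≡ blockDegree m L (toℕ v)
  classDeg-color v = begin
    classDeg (K m n) color v
      ≡⟨ length-filterᵇ-tabulate id _ _ (λ w → trans (∧-comm (bip m n v w) _) (cong₂ _∧_
           (trans (does-≟ (color w) (color v)) (cong₂ _≡ᵇ_ (toℕ-color w) (toℕ-color v)))
           (bip≡crossing m n v w))) ⟩
    count (λ l → (block L l ≡ᵇ block L (toℕ v)) ∧ crossing m (toℕ v) l) (m + n)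
      ≡⟨ cong (count _) (sym sum≡) ⟩
    blockDegree m L (toℕ v) ∎
    where open ≡-Reasoning

  equitableTreeColorable : All (EquitableSize (m + n) (length L)) L → Admissible m L →
    EquitableTreeColorable (K m n) (length L) 1
  equitableTreeColorable sizes adm = color , equitable , classDeg≤1⇒¬CycleIn (K m n) color deg≤1 , deg≤1
    where
      deg≤1 : ∀ v → classDeg (K m n) color v ≤ 1
      deg≤1 v = subst (_≤ 1) (sym (classDeg-color v))
                  (blockDegree≤1 m L (toℕ v) adm (subst (toℕ v <_) (sym sum≡) (toℕ<n v)))
      equitable : IsEquitable (K m n) color
      equitable i rewrite classSize-color i = All.lookup sizes (∈-lookup i)

[r+k*n]/n≡k : ∀ {r n} k .{{_ : NonZero n}} → r < n → (r + k * n) / n ≡ k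
[r+k*n]/n≡k {r} {n} k r<n =
  trans (+-distrib-/-∣ʳ r (n∣m*n k)) (cong₂ _+_ (m<n⇒m/n≡0 r<n) (m*n/n≡m k n))

floorDiv-unique : ∀ {N q t} s → N ≡ t + s * q → t < q → floorDiv N q ≡ s
floorDiv-unique {q = suc q} s refl t<q = [r+k*n]/n≡k s t<q

ceilDiv-unique : ∀ {N q t} s → N ≡ t + s * q → t < q → 0 < t → ceilDiv N q ≡ suc s
ceilDiv-unique {q = suc q} {suc t} s refl t<q _ =
  trans (cong (_/ suc q) (shift t s q)) ([r+k*n]/n≡k (suc s) (<-trans (n<1+n t) t<q))
  where
    shift : ∀ t s q → suc t + s * suc q + q ≡ t + suc s * suc q
    shift = solve-∀

runs : (s x₁ y₁ x₂ y₂ : ℕ) → List ℕ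
runs s x₁ y₁ x₂ y₂ = replicate x₁ (suc s) ++ replicate y₁ s ++ replicate x₂ (suc s) ++ replicate y₂ s

sum-replicate : ∀ n a → sum (replicate n a) ≡ n * a
sum-replicate zero    a = refl
sum-replicate (suc n) a = cong (a +_) (sum-replicate n a)

length-runs : ∀ s x₁ y₁ x₂ y₂ → length (runs s x₁ y₁ x₂ y₂) ≡ (x₁ + x₂) + (y₁ + y₂)
length-runs s x₁ y₁ x₂ y₂ = begin
  length (R₁ ++ R₂ ++ R₃ ++ R₄)
    ≡⟨ trans (length-++ R₁) (cong (length R₁ +_) (trans (length-++ R₂) (cong (length R₂ +_) (length-++ R₃)))) ⟩
  length R₁ + (length R₂ + (length R₃ + length R₄))
    ≡⟨ cong₂ _+_ (length-replicate x₁)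
         (cong₂ _+_ (length-replicate y₁) (cong₂ _+_ (length-replicate x₂) (length-replicate y₂))) ⟩
  x₁ + (y₁ + (x₂ + y₂))
    ≡⟨ regroup x₁ y₁ x₂ y₂ ⟩
  (x₁ + x₂) + (y₁ + y₂) ∎
  where
    open ≡-Reasoning
    R₁ = replicate x₁ (suc s); R₂ = replicate y₁ s; R₃ = replicate x₂ (suc s); R₄ = replicate y₂ s
    regroup : ∀ x₁ y₁ x₂ y₂ → x₁ + (y₁ + (x₂ + y₂)) ≡ (x₁ + x₂) + (y₁ + y₂)
    regroup = solve-∀

sum-runs : ∀ s x₁ y₁ x₂ y₂ → sum (runs s x₁ y₁ x₂ y₂) ≡ (x₁ + x₂) + s * ((x₁ + x₂) + (y₁ + y₂))
sum-runs s x₁ y₁ x₂ y₂ = begin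
  sum (R₁ ++ R₂ ++ R₃ ++ R₄)
    ≡⟨ trans (sum-++ R₁ _) (cong (sum R₁ +_) (trans (sum-++ R₂ _) (cong (sum R₂ +_) (sum-++ R₃ R₄)))) ⟩
  sum R₁ + (sum R₂ + (sum R₃ + sum R₄))
    ≡⟨ cong₂ _+_ (sum-replicate x₁ _)
         (cong₂ _+_ (sum-replicate y₁ _) (cong₂ _+_ (sum-replicate x₂ _) (sum-replicate y₂ _))) ⟩
  x₁ * suc s + (y₁ * s + (x₂ * suc s + y₂ * s))
    ≡⟨ regroup s x₁ y₁ x₂ y₂ ⟩
  (x₁ + x₂) + s * ((x₁ + x₂) + (y₁ + y₂)) ∎
  where
    open ≡-Reasoning
    R₁ = replicate x₁ (suc s); R₂ = replicate y₁ s; R₃ = replicate x₂ (suc s); R₄ = replicate y₂ s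
    regroup : ∀ s x₁ y₁ x₂ y₂ →
      x₁ * suc s + (y₁ * s + (x₂ * suc s + y₂ * s)) ≡ (x₁ + x₂) + s * ((x₁ + x₂) + (y₁ + y₂))
    regroup = solve-∀

runs-colorable : ∀ m n {q t} s x₁ y₁ x₂ y₂ → m + n ≡ t + s * q → t < q →
  x₁ + x₂ ≡ t → y₁ + y₂ ≡ q ∸ t → Admissible m (runs s x₁ y₁ x₂ y₂) →
  EquitableTreeColorable (K m n) q 1
runs-colorable m n {q} {t} s x₁ y₁ x₂ y₂ N≡ t<q x≡t y≡q∸t adm =
  subst (λ q → EquitableTreeColorable (K m n) q 1) length≡
    (BlockColoring.equitableTreeColorable m n L sum≡
      (subst (λ q → All (EquitableSize (m + n) q) L) (sym length≡) sizes) adm)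
  where
    L = runs s x₁ y₁ x₂ y₂
    blocks≡q : (x₁ + x₂) + (y₁ + y₂) ≡ q
    blocks≡q = trans (cong₂ _+_ x≡t y≡q∸t) (m+[n∸m]≡n (<⇒≤ t<q))
    length≡ : length L ≡ q
    length≡ = trans (length-runs s x₁ y₁ x₂ y₂) blocks≡q
    sum≡ : sum L ≡ m + n
    sum≡ = trans (sum-runs s x₁ y₁ x₂ y₂) (trans (cong₂ (λ a b → a + s * b) x≡t blocks≡q) (sym N≡))
    large : ∀ x → x ≤ t → All (EquitableSize (m + n) q) (replicate x (suc s))
    large zero    _   = []
    large (suc x) x≤t = replicate⁺ (suc x) (inj₂ (sym (ceilDiv-unique s N≡ t<q (<-≤-trans z<s x≤t))))
    small : ∀ y → All (EquitableSize (m + n) q) (replicate y s)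
    small y = replicate⁺ y (inj₁ (sym (floorDiv-unique s N≡ t<q)))
    sizes : All (EquitableSize (m + n) q) L
    sizes = ++⁺ (large x₁ (subst (x₁ ≤_) x≡t (m≤m+n x₁ x₂)))
           (++⁺ (small y₁) (++⁺ (large x₂ (subst (x₂ ≤_) x≡t (m≤n+m x₂ x₁))) (small y₂)))

admissible-runs-small : ∀ {m} s x₁ y₁ x₂ y₂ → s ≤ 1 → Admissible m (runs s x₁ y₁ x₂ y₂)
admissible-runs-small s x₁ y₁ x₂ y₂ s≤1 = admissible-small
  (++⁺ (replicate⁺ x₁ s+1≤2) (++⁺ (replicate⁺ y₁ s≤2) (++⁺ (replicate⁺ x₂ s+1≤2) (replicate⁺ y₂ s≤2))))
  where
    s+1≤2 = s≤s s≤1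
    s≤2 = m≤n⇒m≤1+n s≤1

admissible-runs-split : ∀ {m} s x₁ y₁ x₂ y₂ → s ≤ 2 → x₁ * suc s ≤ m →
  x₂ ≡ 0 ⊎ m ≤ x₁ * suc s + y₁ * s → Admissible m (runs s x₁ y₁ x₂ y₂)
admissible-runs-split {m} s x₁ y₁ x₂ y₂ s≤2 below after =
  admissible-++ (replicate x₁ (suc s))
    (admissible-below _ (subst (_≤ m) (sym (sum-replicate x₁ (suc s))) below)) (rest after)
  where
    m′ = m ∸ sum (replicate x₁ (suc s))
    rest : x₂ ≡ 0 ⊎ m ≤ x₁ * suc s + y₁ * s →
           Admissible m′ (replicate y₁ s ++ replicate x₂ (suc s) ++ replicate y₂ s)
    rest (inj₁ refl) = admissible-small (++⁺ (replicate⁺ y₁ s≤2) (replicate⁺ y₂ s≤2))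
    rest (inj₂ m≤) = admissible-++ (replicate y₁ s) (admissible-small (replicate⁺ y₁ s≤2))
      (subst (λ m → Admissible m (replicate x₂ (suc s) ++ replicate y₂ s)) (sym passed)
             (admissible-above (replicate x₂ (suc s) ++ replicate y₂ s)))
      where
        passed : m′ ∸ sum (replicate y₁ s) ≡ 0
        passed = trans (∸-+-assoc m (sum (replicate x₁ (suc s))) (sum (replicate y₁ s))) (m≤n⇒m∸n≡0
          (subst (m ≤_) (sym (cong₂ _+_ (sum-replicate x₁ (suc s)) (sum-replicate y₁ s))) m≤))

colorable-quotient≤1 : ∀ m n {q t} s → s ≤ 1 → m + n ≡ t + s * q → t < q →
  EquitableTreeColorable (K m n) q 1
colorable-quotient≤1 m n {q} {t} s s≤1 N≡ t<q =
  runs-colorable m n s t (q ∸ t) 0 0 N≡ t<q (+-identityʳ t) (+-identityʳ (q ∸ t))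
    (admissible-runs-small s t (q ∸ t) 0 0 s≤1)

colorable-quotient≡2 : ∀ m n {q t} b → 3 * b ≤ m → m ≤ 3 * b + 2 → m + n ≡ t + 2 * q → t < q →
  EquitableTreeColorable (K m n) q 1
colorable-quotient≡2 m n {q} {t} b 3b≤m m≤3b+2 N≡ t<q = byTriples (t ≤? b)
  where
    b*3≤m = subst (_≤ m) (*-comm 3 b) 3b≤m
    byTriples : Dec (t ≤ b) → EquitableTreeColorable (K m n) q 1
    byTriples (yes t≤b) = runs-colorable m n 2 t (q ∸ t) 0 0 N≡ t<q (+-identityʳ t) (+-identityʳ (q ∸ t))
      (admissible-runs-split 2 t (q ∸ t) 0 0 ≤-refl (≤-trans (*-monoˡ-≤ 3 t≤b) b*3≤m) (inj₁ refl))
    byTriples (no t≰b) = runs-colorable m n 2 b 1 (t ∸ b) (q ∸ t ∸ 1) N≡ t<q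
      (m+[n∸m]≡n (<⇒≤ (≰⇒> t≰b))) (m+[n∸m]≡n (m<n⇒0<n∸m t<q))
      (admissible-runs-split 2 b 1 (t ∸ b) (q ∸ t ∸ 1) ≤-refl b*3≤m
        (inj₂ (subst (λ x → m ≤ x + 2) (*-comm 3 b) m≤3b+2)))

lemma4 : (b c g h : ℕ) → g ≤ 2 → h ≤ 2 →
    1 ≤ 3 * b + g → 1 ≤ 3 * c + h →
    StrongVaAtMost (K (3 * b + g) (3 * c + h)) 1 (b + c + 2)
lemma4 b c g h g≤2 h≤2 _ _ q b+c+2≤q = colorable (m≤n⇒m<n∨m≡n quotient≤2)
  where
    m = 3 * b + g
    n = 3 * c + h
    instance
      q≢0 : NonZero q
      q≢0 = >-nonZero (<-≤-trans z<s (≤-trans (m≤n+m 2 (b + c)) b+c+2≤q))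
    N≡ : m + n ≡ (m + n) % q + (m + n) / q * q
    N≡ = m≡m%n+[m/n]*n (m + n) q
    N<3q : m + n < 3 * q
    N<3q = begin-strict
      3 * b + g + (3 * c + h)     ≤⟨ +-mono-≤ (+-monoʳ-≤ (3 * b) g≤2) (+-monoʳ-≤ (3 * c) h≤2) ⟩
      3 * b + 2 + (3 * c + 2)     <⟨ m<m+n _ z<s ⟩
      3 * b + 2 + (3 * c + 2) + 2 ≡⟨ regroup b c ⟩
      3 * (b + c + 2)             ≤⟨ *-monoʳ-≤ 3 b+c+2≤q ⟩
      3 * q                       ∎
      where
        open ≤-Reasoning
        regroup : ∀ b c → 3 * b + 2 + (3 * c + 2) + 2 ≡ 3 * (b + c + 2)
        regroup = solve-∀
    quotient≤2 : (m + n) / q ≤ 2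
    quotient≤2 = ≤-pred (m<n*o⇒m/o<n N<3q)
    colorable : (m + n) / q < 2 ⊎ (m + n) / q ≡ 2 → EquitableTreeColorable (K m n) q 1
    colorable (inj₁ s<2) = colorable-quotient≤1 m n _ (≤-pred s<2) N≡ (m%n<n (m + n) q)
    colorable (inj₂ s≡2) = colorable-quotient≡2 m n b (m≤m+n (3 * b) g) (+-monoʳ-≤ (3 * b) g≤2)
      (subst (λ s → m + n ≡ (m + n) % q + s * q) s≡2 N≡) (m%n<n (m + n) q)
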